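{- Let $i\in\mathbb{Z}_{\geq1}$. Then $T_{2,(i,2)}:=\mathrm{conv}\left((0,1),(1,-1),\left(i+\tfrac12,0\right)\right)\subseteq\mathbb{R}^2$ is a half-integral pseudo-integral triangle with exactly $i$ interior lattice points and exactly $2$ boundary lattice points.
   Context: A rational polygon is half-integral if the smallest positive integer $d$ such that $dP$ has all vertices in $\mathbb{Z}^2$ is $2$. It is pseudo-integral if its Ehrhart quasi-polynomial ($L_P(k)=|kP\cap\mathbb{Z}^2|$ for positive integers $k$) is a polynomial. -}

module Defs where

open import Data.Nat using (ℕ; suc; _≤_; _<_)
open import Data.Integer using (ℤ; +_)
open import Data.Rational using (ℚ; _/_; 0ℚ; 1ℚ; _+_; _*_; _-_; ∣_∣)
import Data.Rational as Q
open import Data.Product using (Σ; ∃; _×_; _,_; proj₁; proj₂)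
open import Data.List using (List; []; _∷_; length)
open import Data.List.Membership.Propositional using (_∈_)
open import Data.List.Relation.Unary.Unique.Propositional using (Unique)
open import Relation.Binary.PropositionalEquality using (_≡_; _≢_)
open import Relation.Nullary using (¬_)
open import Function.Bundles using (_⇔_)

Pt : Set
Pt = ℚ × ℚ

ZPt : Set
ZPt = ℤ × ℤ

ι : ℤ → ℚ
ι z = z / 1

ιP : ZPt → Pt
ιP (a , b) = (ι a , ι b)

_·_ : ℚ → Pt → Pt
r · (x , y) = (r * x , r * y)

_⊕_ : Pt → Pt → Pt
(x , y) ⊕ (x' , y') = (x + x' , y + y')

infixr 7 _·_
infixl 6 _⊕_

Region : Set₁
Region = Pt → Set

-- conv(a, b, c): rational points that are convex combinations of a, b, c.
-- (For a polygon with rational vertices, P ∩ ℚ² determines P, and all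
-- lattice-point questions only involve rational points.)
conv3 : Pt → Pt → Pt → Region
conv3 a b c p =
  Σ ℚ λ l₁ → Σ ℚ λ l₂ → Σ ℚ λ l₃ →
    (0ℚ Q.≤ l₁) × (0ℚ Q.≤ l₂) × (0ℚ Q.≤ l₃) ×
    (l₁ + l₂ + l₃ ≡ 1ℚ) ×
    (p ≡ l₁ · a ⊕ l₂ · b ⊕ l₃ · c)

dilate : ℕ → Region → Region
dilate k P p = Σ Pt λ q → P q × (p ≡ (+ k / 1) · q)

-- topological interior (in ℝ²) of a closed convex rational region, tested
-- on rational points: p has an open box of rational radius ε > 0 inside P.
Interior : Region → Region
Interior P (x , y) =
  Σ ℚ λ ε → (0ℚ Q.< ε) ×
    (∀ (x' y' : ℚ) → ∣ x' - x ∣ Q.< ε → ∣ y' - y ∣ Q.< ε → P (x' , y'))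

Boundary : Region → Region
Boundary P p = P p × ¬ Interior P p

HasCard : (ZPt → Set) → ℕ → Set
HasCard S n = Σ (List ZPt) λ xs →
  Unique xs × (length xs ≡ n) × (∀ z → (S z ⇔ (z ∈ xs)))

LatticePts : Region → ZPt → Set
LatticePts P z = P (ιP z)

IsLattice : Pt → Set
IsLattice (x , y) = Σ ℤ λ a → Σ ℤ λ b → (x ≡ ι a) × (y ≡ ι b)

NonDegenerate : Pt → Pt → Pt → Set
NonDegenerate (a₁ , a₂) (b₁ , b₂) (c₁ , c₂) =
  (b₁ - a₁) * (c₂ - a₂) - (b₂ - a₂) * (c₁ - a₁) ≢ 0ℚ

DilIntegral : ℕ → Pt → Pt → Pt → Set
DilIntegral d a b c =
  IsLattice ((+ d / 1) · a) × IsLattice ((+ d / 1) · b) × IsLattice ((+ d / 1) · c)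

HalfIntegral : Pt → Pt → Pt → Set
HalfIntegral a b c =
  DilIntegral 2 a b c × (∀ d → 1 ≤ d → d < 2 → ¬ DilIntegral d a b c)

evalPoly : List ℚ → ℚ → ℚ
evalPoly [] x = 0ℚ
evalPoly (c ∷ cs) x = c + x * evalPoly cs x

PseudoIntegral : Region → Set
PseudoIntegral P =
  Σ (List ℚ) λ cs → ∀ k → 1 ≤ k →
    Σ ℕ λ n → HasCard (LatticePts (dilate k P)) n × (+ n / 1 ≡ evalPoly cs (+ k / 1))

module Submission where

-- With c = i + ½ the triangle T = conv((0,1), (1,-1), (c,0)) is positively oriented with doubled area 2i, so a
-- rational point lies in kT exactly when its three edge orientations (Cramer's numerators for its barycentric
-- coordinates) are non-negative.  For a lattice point (a, b) and m = 2i + 1 these become the integer conditions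
-- k - b ≤ 2a ≤ m (k - b) and 2 (a + b) ≤ m (k + b).  On or above the x-axis the lattice points of kT therefore
-- form the rows t ≤ 2a ≤ m t (t = k - b = 0, …, k), of length i t + 1 for even t and i t for odd t, and the
-- lattice-preserving shear (a, b) ↦ (a + b, -1 - b) maps the points below the axis onto those of (k - 1)T on or
-- above it.  Summing the rows gives |kT ∩ ℤ²| = 1 + k + i k².  For k = 1 the lattice points are (0,1) and (1,-1),
-- which lie on the edge 2x + y = 1 and so on the boundary, and (1,0), …, (i,0), whose orientations are all at
-- least ½, so that a small box around each of them stays inside T.

open import Defs
open import Data.Nat as ℕ using (ℕ; zero; suc; s≤s; z≤n)
import Data.Nat.Properties as ℕP
open import Data.Nat.Solver using () renaming (module +-*-Solver to ℕ-Solver)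
open import Data.Integer as ℤ using (ℤ; +_; -[1+_]; 0ℤ)
import Data.Integer.Properties as ℤP
open import Data.Integer.Solver using () renaming (module +-*-Solver to ℤ-Solver)
open import Data.Rational as ℚ using (ℚ; mkℚ; _/_; 0ℚ; 1ℚ; ½)
import Data.Rational.Properties as ℚP
open import Data.Rational.Solver using () renaming (module +-*-Solver to ℚ-Solver)
import Data.Nat.Coprimality as Coprime
open import Data.List using ([]; _∷_; _++_; map)
import Data.List.Properties as List
open import Data.List.Membership.Propositional using (_∈_)
import Data.List.Membership.Propositional.Properties as ∈
open import Data.List.Relation.Unary.All using ([])
open import Data.List.Relation.Unary.Any using (here)
open import Data.List.Relation.Unary.Unique.Propositional using ([]; _∷_)
import Data.List.Relation.Unary.Unique.Propositional.Properties as Unique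
open import Data.Product using (Σ; _×_; _,_)
open import Data.Sum as Sum using (_⊎_; inj₁; inj₂)
open import Data.Empty using (⊥-elim)
open import Relation.Nullary using (¬_; yes; no)
open import Function using (_∘_; case_of_)
open import Function.Bundles using (_⇔_; mk⇔; module Equivalence)
open import Function.Construct.Composition using (_⇔-∘_)
open import Relation.Binary.PropositionalEquality

open Equivalence using (to; from)

module _ where
  open import Data.Rational using (_+_; _*_; _-_; -_; _≤_; _<_)

  ι≡mkℚ : ∀ z → ι z ≡ mkℚ z 0 (Coprime.sym (Coprime.1-coprimeTo _))
  ι≡mkℚ z = ℚP.↥p/↧p≡p (mkℚ z 0 _)

  ι-+ : ∀ a b → ι (a ℤ.+ b) ≡ ι a + ι b
  ι-+ a b rewrite ι≡mkℚ a | ι≡mkℚ b =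
    cong (_/ 1) (sym (cong₂ ℤ._+_ (ℤP.*-identityʳ a) (ℤP.*-identityʳ b)))

  ι-* : ∀ a b → ι (a ℤ.* b) ≡ ι a * ι b
  ι-* a b rewrite ι≡mkℚ a | ι≡mkℚ b = refl

  ι-ℕ-* : ∀ a b → ι (+ (a ℕ.* b)) ≡ ι (+ a) * ι (+ b)
  ι-ℕ-* a b = trans (cong ι (ℤP.pos-* a b)) (ι-* (+ a) (+ b))

  ι-neg : ∀ a → ι (ℤ.- a) ≡ - ι a
  ι-neg (+ zero) = refl
  ι-neg (+ suc n) = refl
  ι-neg -[1+ n ] rewrite ι≡mkℚ -[1+ n ] = ι≡mkℚ (+ suc n)

  ι-minus : ∀ a b → ι (a ℤ.- b) ≡ ι a - ι b
  ι-minus a b = trans (ι-+ a (ℤ.- b)) (cong (_+_ (ι a)) (ι-neg b))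

  ι-mono-≤ : ∀ {a b} → a ℤ.≤ b → ι a ≤ ι b
  ι-mono-≤ {a} {b} a≤b rewrite ι≡mkℚ a | ι≡mkℚ b =
    ℚ.*≤* (subst₂ ℤ._≤_ (sym (ℤP.*-identityʳ a)) (sym (ℤP.*-identityʳ b)) a≤b)

  ι-cancel-≤ : ∀ {a b} → ι a ≤ ι b → a ℤ.≤ b
  ι-cancel-≤ {a} {b} ιa≤ιb rewrite ι≡mkℚ a | ι≡mkℚ b with ιa≤ιb
  ... | ℚ.*≤* a≤b = subst₂ ℤ._≤_ (ℤP.*-identityʳ a) (ℤP.*-identityʳ b) a≤b

  ι-injective : ∀ {a b} → ι a ≡ ι b → a ≡ b
  ι-injective ιa≡ιb =
    ℤP.≤-antisym (ι-cancel-≤ (ℚP.≤-reflexive ιa≡ιb)) (ι-cancel-≤ (ℚP.≤-reflexive (sym ιa≡ιb)))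

  ι-pos : ∀ k .{{_ : ℕ.NonZero k}} → 0ℚ < ι (+ k)
  ι-pos k = ℚP.positive⁻¹ (ι (+ k)) {{ℚP.normalize-pos k 1}}

  /2≡*½ : ∀ z → z / 2 ≡ ι z * ½
  /2≡*½ z rewrite ι≡mkℚ z = cong (_/ 2) (sym (ℤP.*-identityʳ z))

  0≤-* : ∀ {x y} → 0ℚ ≤ x → 0ℚ ≤ y → 0ℚ ≤ x * y
  0≤-* {x} {y} 0≤x 0≤y =
    ℚP.nonNegative⁻¹ _ {{ℚP.nonNeg*nonNeg⇒nonNeg x {{ℚ.nonNegative 0≤x}} y {{ℚ.nonNegative 0≤y}}}}

  0<-* : ∀ {x y} → 0ℚ < x → 0ℚ < y → 0ℚ < x * y
  0<-* {x} {y} 0<x 0<y = ℚP.positive⁻¹ _ {{ℚP.pos*pos⇒pos x {{ℚ.positive 0<x}} y {{ℚ.positive 0<y}}}}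

  ≤⇒0≤- : ∀ {p q} → p ≤ q → 0ℚ ≤ q - p
  ≤⇒0≤- {p} {q} p≤q = subst (_≤ q - p) (ℚP.+-inverseʳ p) (ℚP.+-monoˡ-≤ (- p) p≤q)

  0≤-⇒≤ : ∀ {p q} → 0ℚ ≤ q - p → p ≤ q
  0≤-⇒≤ {p} {q} 0≤q-p =
    subst₂ _≤_ (ℚP.+-identityˡ p) (solve 2 (λ p q → q :- p :+ p := q) refl p q) (ℚP.+-monoˡ-≤ p 0≤q-p)
    where open ℚ-Solver

  0≤-scaled-difference⇔ : ∀ {κ o l r} → 0ℚ < κ → o ≡ κ * (ι r - ι l) → 0ℚ ≤ o ⇔ l ℤ.≤ r
  0≤-scaled-difference⇔ {κ} {o} 0<κ o≡ = mk⇔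
    (λ 0≤o → ι-cancel-≤ (0≤-⇒≤ (ℚP.*-cancelˡ-≤-pos κ {{ℚ.positive 0<κ}}
               (subst₂ _≤_ (sym (ℚP.*-zeroʳ κ)) o≡ 0≤o))))
    (λ l≤r → subst (0ℚ ≤_) (sym o≡) (0≤-* (ℚP.<⇒≤ 0<κ) (≤⇒0≤- (ι-mono-≤ l≤r))))

  p≤∣p∣ : ∀ p → p ≤ ℚ.∣ p ∣
  p≤∣p∣ p with ℚP.≤-total p 0ℚ
  ... | inj₁ p≤0 = ℚP.≤-trans p≤0 (ℚP.0≤∣p∣ p)
  ... | inj₂ 0≤p = ℚP.≤-reflexive (sym (ℚP.0≤p⇒∣p∣≡p 0≤p))

  ∣p-p∣≡0 : ∀ p → ℚ.∣ p - p ∣ ≡ 0ℚ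
  ∣p-p∣≡0 p = cong ℚ.∣_∣ (ℚP.+-inverseʳ p)

  ∣p-δ-p∣≡δ : ∀ p {δ} → 0ℚ ≤ δ → ℚ.∣ p - δ - p ∣ ≡ δ
  ∣p-δ-p∣≡δ p {δ} 0≤δ = begin
    ℚ.∣ p - δ - p ∣ ≡⟨ cong ℚ.∣_∣ (solve 2 (λ p δ → p :- δ :- p := :- δ) refl p δ) ⟩
    ℚ.∣ - δ ∣       ≡⟨ ℚP.∣-p∣≡∣p∣ δ ⟩
    ℚ.∣ δ ∣         ≡⟨ ℚP.0≤p⇒∣p∣≡p 0≤δ ⟩
    δ               ∎
    where
    open ≡-Reasoning
    open ℚ-Solver

  ·-combination : ∀ r l₁ l₂ l₃ a b c →
    r · (l₁ · a ⊕ l₂ · b ⊕ l₃ · c) ≡ (r * l₁) · a ⊕ (r * l₂) · b ⊕ (r * l₃) · c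
  ·-combination r l₁ l₂ l₃ (a₁ , a₂) (b₁ , b₂) (c₁ , c₂) =
    cong₂ _,_ (coordinate a₁ b₁ c₁) (coordinate a₂ b₂ c₂)
    where
    open ℚ-Solver
    coordinate : ∀ x y z → r * (l₁ * x + l₂ * y + l₃ * z) ≡ r * l₁ * x + r * l₂ * y + r * l₃ * z
    coordinate x y z = solve 7 (λ r l₁ l₂ l₃ x y z →
      r :* (l₁ :* x :+ l₂ :* y :+ l₃ :* z) := r :* l₁ :* x :+ r :* l₂ :* y :+ r :* l₃ :* z)
      refl r l₁ l₂ l₃ x y z

  ·-combination-distrib : ∀ r l₁ l₂ l₃ a b c →
    r · (l₁ · a ⊕ l₂ · b ⊕ l₃ · c) ≡ l₁ · (r · a) ⊕ l₂ · (r · b) ⊕ l₃ · (r · c)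
  ·-combination-distrib r l₁ l₂ l₃ (a₁ , a₂) (b₁ , b₂) (c₁ , c₂) =
    cong₂ _,_ (coordinate a₁ b₁ c₁) (coordinate a₂ b₂ c₂)
    where
    open ℚ-Solver
    coordinate : ∀ x y z → r * (l₁ * x + l₂ * y + l₃ * z) ≡ l₁ * (r * x) + l₂ * (r * y) + l₃ * (r * z)
    coordinate x y z = solve 7 (λ r l₁ l₂ l₃ x y z →
      r :* (l₁ :* x :+ l₂ :* y :+ l₃ :* z) := l₁ :* (r :* x) :+ l₂ :* (r :* y) :+ l₃ :* (r :* z))
      refl r l₁ l₂ l₃ x y z

  ·-assoc : ∀ r s p → r · (s · p) ≡ (r * s) · p
  ·-assoc r s (x , y) = sym (cong₂ _,_ (ℚP.*-assoc r s x) (ℚP.*-assoc r s y))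

  ·-identityˡ : ∀ p → 1ℚ · p ≡ p
  ·-identityˡ (x , y) = cong₂ _,_ (ℚP.*-identityˡ x) (ℚP.*-identityˡ y)

  dilate-1⁻ : ∀ {P p} → dilate 1 P p → P p
  dilate-1⁻ {P} (q , Pq , refl) = subst P (sym (·-identityˡ q)) Pq

  dilate-1⁺ : ∀ {P p} → P p → dilate 1 P p
  dilate-1⁺ {P} {p} Pp = p , Pp , sym (·-identityˡ p)

  dilate-conv3⁻ : ∀ k {a b c p} → dilate k (conv3 a b c) p → conv3 (ι (+ k) · a) (ι (+ k) · b) (ι (+ k) · c) p
  dilate-conv3⁻ k {a} {b} {c} (_ , (l₁ , l₂ , l₃ , 0≤l₁ , 0≤l₂ , 0≤l₃ , sum≡1 , refl) , refl) =
    l₁ , l₂ , l₃ , 0≤l₁ , 0≤l₂ , 0≤l₃ , sum≡1 , ·-combination-distrib (ι (+ k)) l₁ l₂ l₃ a b c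

  dilate-conv3⁺ : ∀ k {a b c p} → conv3 (ι (+ k) · a) (ι (+ k) · b) (ι (+ k) · c) p → dilate k (conv3 a b c) p
  dilate-conv3⁺ k {a} {b} {c} (l₁ , l₂ , l₃ , 0≤l₁ , 0≤l₂ , 0≤l₃ , sum≡1 , refl) =
    l₁ · a ⊕ l₂ · b ⊕ l₃ · c , (l₁ , l₂ , l₃ , 0≤l₁ , 0≤l₂ , 0≤l₃ , sum≡1 , refl) ,
    sym (·-combination-distrib (ι (+ k)) l₁ l₂ l₃ a b c)

  -- Orientation and triangle membership

  orientation : Pt → Pt → Pt → ℚ
  orientation (a₁ , a₂) (b₁ , b₂) (c₁ , c₂) = (b₁ - a₁) * (c₂ - a₂) - (b₂ - a₂) * (c₁ - a₁)

  -- The same expression in the syntax of the ring solver, so that identities between orientations of points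
  -- with solver variables as coordinates are proved by a single call to solve.
  orientationᴾ : ∀ {n} → let P = ℚ-Solver.Polynomial n in P × P → P × P → P × P → P
  orientationᴾ (a₁ , a₂) (b₁ , b₂) (c₁ , c₂) = (b₁ :- a₁) :* (c₂ :- a₂) :- (b₂ :- a₂) :* (c₁ :- a₁)
    where open ℚ-Solver

  LeftOfEdges : Pt → Pt → Pt → Region
  LeftOfEdges a b c p = 0ℚ ≤ orientation b c p × 0ℚ ≤ orientation c a p × 0ℚ ≤ orientation a b p

  orientation-· : ∀ r a b c → orientation (r · a) (r · b) (r · c) ≡ (r * r) * orientation a b c
  orientation-· r (a₁ , a₂) (b₁ , b₂) (c₁ , c₂) = solve 7 (λ r a₁ a₂ b₁ b₂ c₁ c₂ →
    orientationᴾ (r :* a₁ , r :* a₂) (r :* b₁ , r :* b₂) (r :* c₁ , r :* c₂)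
    := (r :* r) :* orientationᴾ (a₁ , a₂) (b₁ , b₂) (c₁ , c₂)) refl r a₁ a₂ b₁ b₂ c₁ c₂
    where open ℚ-Solver

  cramer-sum : ∀ a b c p → orientation b c p + orientation c a p + orientation a b p ≡ orientation a b c
  cramer-sum (a₁ , a₂) (b₁ , b₂) (c₁ , c₂) (p₁ , p₂) = solve 8 (λ a₁ a₂ b₁ b₂ c₁ c₂ p₁ p₂ →
    orientationᴾ (b₁ , b₂) (c₁ , c₂) (p₁ , p₂) :+ orientationᴾ (c₁ , c₂) (a₁ , a₂) (p₁ , p₂)
      :+ orientationᴾ (a₁ , a₂) (b₁ , b₂) (p₁ , p₂)
    := orientationᴾ (a₁ , a₂) (b₁ , b₂) (c₁ , c₂)) refl a₁ a₂ b₁ b₂ c₁ c₂ p₁ p₂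
    where open ℚ-Solver

  cramer : ∀ a b c p →
    orientation b c p · a ⊕ orientation c a p · b ⊕ orientation a b p · c ≡ orientation a b c · p
  cramer (a₁ , a₂) (b₁ , b₂) (c₁ , c₂) (p₁ , p₂) = cong₂ _,_
    (solve 8 (λ a₁ a₂ b₁ b₂ c₁ c₂ p₁ p₂ →
      orientationᴾ (b₁ , b₂) (c₁ , c₂) (p₁ , p₂) :* a₁
        :+ orientationᴾ (c₁ , c₂) (a₁ , a₂) (p₁ , p₂) :* b₁
        :+ orientationᴾ (a₁ , a₂) (b₁ , b₂) (p₁ , p₂) :* c₁
      := orientationᴾ (a₁ , a₂) (b₁ , b₂) (c₁ , c₂) :* p₁) refl a₁ a₂ b₁ b₂ c₁ c₂ p₁ p₂)
    (solve 8 (λ a₁ a₂ b₁ b₂ c₁ c₂ p₁ p₂ →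
      orientationᴾ (b₁ , b₂) (c₁ , c₂) (p₁ , p₂) :* a₂
        :+ orientationᴾ (c₁ , c₂) (a₁ , a₂) (p₁ , p₂) :* b₂
        :+ orientationᴾ (a₁ , a₂) (b₁ , b₂) (p₁ , p₂) :* c₂
      := orientationᴾ (a₁ , a₂) (b₁ , b₂) (c₁ , c₂) :* p₂) refl a₁ a₂ b₁ b₂ c₁ c₂ p₁ p₂)
    where open ℚ-Solver

  barycentric : ∀ a b c {l₁ l₂ l₃} → l₁ + l₂ + l₃ ≡ 1ℚ → let p = l₁ · a ⊕ l₂ · b ⊕ l₃ · c in
    orientation b c p ≡ l₁ * orientation a b c ×
    orientation c a p ≡ l₂ * orientation a b c ×
    orientation a b p ≡ l₃ * orientation a b c
  barycentric (a₁ , a₂) (b₁ , b₂) (c₁ , c₂) {l₁} {l₂} {l₃} sum≡1 =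
    trans (cong (orientation b c) p≡p₀) o₁ ,
    trans (cong (orientation c a) p≡p₀) o₂ ,
    trans (cong (orientation a b) p≡p₀) (trans o₃ (cong (_* orientation a b c) (sym l₃≡)))
    where
    open ℚ-Solver
    a b c p₀ : Pt
    a = (a₁ , a₂)
    b = (b₁ , b₂)
    c = (c₁ , c₂)
    p₀ = l₁ · a ⊕ l₂ · b ⊕ (1ℚ - l₁ - l₂) · c
    l₃≡ : l₃ ≡ 1ℚ - l₁ - l₂
    l₃≡ = trans (solve 3 (λ l₁ l₂ l₃ → l₃ := l₁ :+ l₂ :+ l₃ :- l₁ :- l₂) refl l₁ l₂ l₃)
                (cong (λ s → s - l₁ - l₂) sum≡1)
    p≡p₀ : l₁ · a ⊕ l₂ · b ⊕ l₃ · c ≡ p₀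
    p≡p₀ = cong (λ l → l₁ · a ⊕ l₂ · b ⊕ l · c) l₃≡
    combination : ∀ {n} → Polynomial n → Polynomial n → Polynomial n → Polynomial n → Polynomial n → Polynomial n
    combination a b c l₁ l₂ = l₁ :* a :+ l₂ :* b :+ (con 1ℚ :- l₁ :- l₂) :* c
    o₁ : orientation b c p₀ ≡ l₁ * orientation a b c
    o₁ = solve 8 (λ a₁ a₂ b₁ b₂ c₁ c₂ l₁ l₂ →
      orientationᴾ (b₁ , b₂) (c₁ , c₂) (combination a₁ b₁ c₁ l₁ l₂ , combination a₂ b₂ c₂ l₁ l₂)
      := l₁ :* orientationᴾ (a₁ , a₂) (b₁ , b₂) (c₁ , c₂)) refl a₁ a₂ b₁ b₂ c₁ c₂ l₁ l₂
    o₂ : orientation c a p₀ ≡ l₂ * orientation a b c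
    o₂ = solve 8 (λ a₁ a₂ b₁ b₂ c₁ c₂ l₁ l₂ →
      orientationᴾ (c₁ , c₂) (a₁ , a₂) (combination a₁ b₁ c₁ l₁ l₂ , combination a₂ b₂ c₂ l₁ l₂)
      := l₂ :* orientationᴾ (a₁ , a₂) (b₁ , b₂) (c₁ , c₂)) refl a₁ a₂ b₁ b₂ c₁ c₂ l₁ l₂
    o₃ : orientation a b p₀ ≡ (1ℚ - l₁ - l₂) * orientation a b c
    o₃ = solve 8 (λ a₁ a₂ b₁ b₂ c₁ c₂ l₁ l₂ →
      orientationᴾ (a₁ , a₂) (b₁ , b₂) (combination a₁ b₁ c₁ l₁ l₂ , combination a₂ b₂ c₂ l₁ l₂)
      := (con 1ℚ :- l₁ :- l₂) :* orientationᴾ (a₁ , a₂) (b₁ , b₂) (c₁ , c₂))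
      refl a₁ a₂ b₁ b₂ c₁ c₂ l₁ l₂

  conv3⇒LeftOfEdges : ∀ {a b c p} → 0ℚ ≤ orientation a b c → conv3 a b c p → LeftOfEdges a b c p
  conv3⇒LeftOfEdges {a} {b} {c} 0≤D (l₁ , l₂ , l₃ , 0≤l₁ , 0≤l₂ , 0≤l₃ , sum≡1 , refl) =
    let o₁ , o₂ , o₃ = barycentric a b c {l₁} {l₂} {l₃} sum≡1
    in  weighted 0≤l₁ o₁ , weighted 0≤l₂ o₂ , weighted 0≤l₃ o₃
    where
    weighted : ∀ {l o} → 0ℚ ≤ l → o ≡ l * orientation a b c → 0ℚ ≤ o
    weighted 0≤l o≡ = subst (0ℚ ≤_) (sym o≡) (0≤-* 0≤l 0≤D)

  LeftOfEdges⇒conv3 : ∀ {a b c p} → 0ℚ < orientation a b c → LeftOfEdges a b c p → conv3 a b c p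
  LeftOfEdges⇒conv3 {a} {b} {c} {p} 0<D (0≤o₁ , 0≤o₂ , 0≤o₃) =
    r * o₁ , r * o₂ , r * o₃ , 0≤-* 0≤r 0≤o₁ , 0≤-* 0≤r 0≤o₂ , 0≤-* 0≤r 0≤o₃ ,
    weights-sum , sym combination≡p
    where
    open ≡-Reasoning
    D o₁ o₂ o₃ r : ℚ
    D = orientation a b c
    o₁ = orientation b c p
    o₂ = orientation c a p
    o₃ = orientation a b p
    instance
      D-positive : ℚ.Positive D
      D-positive = ℚ.positive 0<D
      D-nonZero : ℚ.NonZero D
      D-nonZero = ℚP.pos⇒nonZero D
    r = ℚ.1/ D
    0≤r : 0ℚ ≤ r
    0≤r = ℚP.<⇒≤ (ℚP.positive⁻¹ r {{ℚP.1/pos⇒pos D}})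
    weights-sum : r * o₁ + r * o₂ + r * o₃ ≡ 1ℚ
    weights-sum = begin
      r * o₁ + r * o₂ + r * o₃ ≡⟨ solve 4 (λ r x y z → r :* x :+ r :* y :+ r :* z := r :* (x :+ y :+ z))
                                          refl r o₁ o₂ o₃ ⟩
      r * (o₁ + o₂ + o₃)       ≡⟨ cong (r *_) (cramer-sum a b c p) ⟩
      r * D                    ≡⟨ ℚP.*-inverseˡ D ⟩
      1ℚ                       ∎
      where open ℚ-Solver
    combination≡p : (r * o₁) · a ⊕ (r * o₂) · b ⊕ (r * o₃) · c ≡ p
    combination≡p = begin
      (r * o₁) · a ⊕ (r * o₂) · b ⊕ (r * o₃) · c ≡⟨ ·-combination r o₁ o₂ o₃ a b c ⟨
      r · (o₁ · a ⊕ o₂ · b ⊕ o₃ · c)             ≡⟨ cong (r ·_) (cramer a b c p) ⟩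
      r · (D · p)                                ≡⟨ ·-assoc r D p ⟩
      (r * D) · p                                ≡⟨ cong (_· p) (ℚP.*-inverseˡ D) ⟩
      1ℚ · p                                     ≡⟨ ·-identityˡ p ⟩
      p                                          ∎

  -- Interior points

  Interior⇒∈ : ∀ {P p} → Interior P p → P p
  Interior⇒∈ {p = x , y} (ε , 0<ε , box) =
    box x y (subst (_< ε) (sym (∣p-p∣≡0 x)) 0<ε) (subst (_< ε) (sym (∣p-p∣≡0 y)) 0<ε)

  Interior-shiftˡ : ∀ {P x y} → Interior P (x , y) → Σ ℚ λ δ → 0ℚ < δ × P (x - δ , y)
  Interior-shiftˡ {x = x} {y} (ε , 0<ε , box) =
    let δ , 0<δ , δ<ε = ℚP.<-dense 0<ε
    in  δ , 0<δ , box (x - δ) y (subst (_< ε) (sym (∣p-δ-p∣≡δ x (ℚP.<⇒≤ 0<δ))) δ<ε)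
                                (subst (_< ε) (sym (∣p-p∣≡0 y)) 0<ε)

  ℓ¹ : Pt → Pt → ℚ
  ℓ¹ (a₁ , a₂) (b₁ , b₂) = ℚ.∣ b₁ - a₁ ∣ + ℚ.∣ b₂ - a₂ ∣

  orientation-margin : ∀ a b x y x′ y′ {ε} → ℚ.∣ x′ - x ∣ ≤ ε → ℚ.∣ y′ - y ∣ ≤ ε →
                       ℓ¹ a b * ε ≤ orientation a b (x , y) → 0ℚ ≤ orientation a b (x′ , y′)
  orientation-margin (a₁ , a₂) (b₁ , b₂) x y x′ y′ {ε} ∣u∣≤ε ∣v∣≤ε margin =
    subst (0ℚ ≤_) (solve 2 (λ o o′ → o :- (o :- o′) := o′) refl o o′) (≤⇒0≤- o-o′≤o)
    where
    open ℚ-Solver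
    α β u v o o′ : ℚ
    α = b₁ - a₁
    β = b₂ - a₂
    u = x′ - x
    v = y′ - y
    o = orientation (a₁ , a₂) (b₁ , b₂) (x , y)
    o′ = orientation (a₁ , a₂) (b₁ , b₂) (x′ , y′)
    o-o′≤o : o - o′ ≤ o
    o-o′≤o = begin
      o - o′                                ≡⟨ solve 8 (λ a₁ a₂ b₁ b₂ x y x′ y′ →
                                                 orientationᴾ (a₁ , a₂) (b₁ , b₂) (x , y)
                                                   :- orientationᴾ (a₁ , a₂) (b₁ , b₂) (x′ , y′)
                                                 := (b₂ :- a₂) :* (x′ :- x) :- (b₁ :- a₁) :* (y′ :- y))
                                               refl a₁ a₂ b₁ b₂ x y x′ y′ ⟩
      β * u - α * v                         ≤⟨ p≤∣p∣ (β * u - α * v) ⟩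
      ℚ.∣ β * u - α * v ∣                   ≤⟨ ℚP.∣p-q∣≤∣p∣+∣q∣ (β * u) (α * v) ⟩
      ℚ.∣ β * u ∣ + ℚ.∣ α * v ∣             ≡⟨ cong₂ _+_ (ℚP.∣p*q∣≡∣p∣*∣q∣ β u) (ℚP.∣p*q∣≡∣p∣*∣q∣ α v) ⟩
      ℚ.∣ β ∣ * ℚ.∣ u ∣ + ℚ.∣ α ∣ * ℚ.∣ v ∣ ≤⟨ ℚP.+-mono-≤ (∣·∣*-mono β ∣u∣≤ε) (∣·∣*-mono α ∣v∣≤ε) ⟩
      ℚ.∣ β ∣ * ε + ℚ.∣ α ∣ * ε             ≡⟨ solve 3 (λ A B ε → B :* ε :+ A :* ε := (A :+ B) :* ε)
                                                     refl ℚ.∣ α ∣ ℚ.∣ β ∣ ε ⟩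
      ℓ¹ (a₁ , a₂) (b₁ , b₂) * ε             ≤⟨ margin ⟩
      o                                     ∎
      where
      open ℚP.≤-Reasoning
      ∣·∣*-mono : ∀ γ {w} → ℚ.∣ w ∣ ≤ ε → ℚ.∣ γ ∣ * ℚ.∣ w ∣ ≤ ℚ.∣ γ ∣ * ε
      ∣·∣*-mono γ = ℚP.*-monoˡ-≤-nonNeg ℚ.∣ γ ∣ {{ℚP.∣-∣-nonNeg γ}}

  conv3-interior : ∀ {a b c x y ε} → 0ℚ < orientation a b c → 0ℚ < ε →
                   ℓ¹ b c * ε ≤ orientation b c (x , y) → ℓ¹ c a * ε ≤ orientation c a (x , y) →
                   ℓ¹ a b * ε ≤ orientation a b (x , y) → Interior (conv3 a b c) (x , y)
  conv3-interior {a} {b} {c} {x} {y} {ε} 0<D 0<ε margin₁ margin₂ margin₃ =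
    ε , 0<ε , λ x′ y′ ∣u∣<ε ∣v∣<ε →
      let ∣u∣≤ε = ℚP.<⇒≤ ∣u∣<ε; ∣v∣≤ε = ℚP.<⇒≤ ∣v∣<ε
      in  LeftOfEdges⇒conv3 0<D (orientation-margin b c x y x′ y′ ∣u∣≤ε ∣v∣≤ε margin₁ ,
                                 orientation-margin c a x y x′ y′ ∣u∣≤ε ∣v∣≤ε margin₂ ,
                                 orientation-margin a b x y x′ y′ ∣u∣≤ε ∣v∣≤ε margin₃)

  -- Counting lattice points

  HasCard-cong : ∀ {S S′ : ZPt → Set} {n} → (∀ z → S z ⇔ S′ z) → HasCard S′ n → HasCard S n
  HasCard-cong S⇔S′ (xs , unique , length≡n , S′⇔∈) = xs , unique , length≡n , λ z → S′⇔∈ z ⇔-∘ S⇔S′ z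

  HasCard-∅ : ∀ {S : ZPt → Set} → (∀ z → ¬ S z) → HasCard S 0
  HasCard-∅ ∉S = [] , [] , refl , λ z → mk⇔ (⊥-elim ∘ ∉S z) λ ()

  HasCard-≡ : ∀ z₀ → HasCard (_≡ z₀) 1
  HasCard-≡ z₀ = z₀ ∷ [] , [] ∷ [] , refl ,
                 λ z → mk⇔ (λ { refl → here refl }) λ { (here z≡z₀) → z≡z₀ }

  HasCard-⊎ : ∀ {S S′ : ZPt → Set} {m n} → HasCard S m → HasCard S′ n → (∀ z → S z → ¬ S′ z) →
              HasCard (λ z → S z ⊎ S′ z) (m ℕ.+ n)
  HasCard-⊎ (xs , unique-xs , length-xs , S⇔∈xs) (ys , unique-ys , length-ys , S′⇔∈ys) disjoint =
    xs ++ ys ,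
    Unique.++⁺ unique-xs unique-ys
      (λ {z} (z∈xs , z∈ys) → disjoint z (from (S⇔∈xs z) z∈xs) (from (S′⇔∈ys z) z∈ys)) ,
    trans (List.length-++ xs) (cong₂ ℕ._+_ length-xs length-ys) ,
    λ z → mk⇔ (Sum.[ ∈.∈-++⁺ˡ ∘ to (S⇔∈xs z) , ∈.∈-++⁺ʳ xs ∘ to (S′⇔∈ys z) ])
              (Sum.map (from (S⇔∈xs z)) (from (S′⇔∈ys z)) ∘ ∈.∈-++⁻ xs)

  HasCard-∘ : ∀ {S : ZPt → Set} {n} (φ ψ : ZPt → ZPt) →
              (∀ z → φ (ψ z) ≡ z) → (∀ z → ψ (φ z) ≡ z) → HasCard S n → HasCard (S ∘ φ) n
  HasCard-∘ {S} φ ψ φψ ψφ (xs , unique , length≡n , S⇔∈) =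
    map ψ xs ,
    Unique.map⁺ (λ {x} {y} ψx≡ψy → trans (sym (φψ x)) (trans (cong φ ψx≡ψy) (φψ y))) unique ,
    trans (List.length-map ψ xs) length≡n ,
    λ z → mk⇔ (λ Sφz → subst (_∈ map ψ xs) (ψφ z) (∈.∈-map⁺ ψ (to (S⇔∈ (φ z)) Sφz)))
              (λ z∈ → let x , x∈xs , z≡ψx = ∈.∈-map⁻ ψ z∈
                      in  subst (S ∘ φ) (sym z≡ψx) (subst S (sym (φψ x)) (from (S⇔∈ x) x∈xs)))

  Segment : ℕ → ℕ → ZPt → Set
  Segment lo len (a , b) = b ≡ 0ℤ × Σ ℕ λ q → a ≡ + q × lo ℕ.≤ q × q ℕ.< lo ℕ.+ len

  HasCard-Segment : ∀ lo len → HasCard (Segment lo len) len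
  HasCard-Segment lo zero = HasCard-∅ λ { _ (_ , q , _ , lo≤q , q<lo+0) →
    ℕP.<-irrefl refl (ℕP.<-≤-trans q<lo+0 (subst (ℕ._≤ q) (sym (ℕP.+-identityʳ lo)) lo≤q)) }
  HasCard-Segment lo (suc len) =
    HasCard-cong split (HasCard-⊎ (HasCard-≡ (+ lo , 0ℤ)) (HasCard-Segment (suc lo) len) first∉rest)
    where
    first∉rest : ∀ z → z ≡ (+ lo , 0ℤ) → ¬ Segment (suc lo) len z
    first∉rest _ refl (_ , q , lo≡q , lo<q , _) = ℕP.<-irrefl (ℤP.+-injective lo≡q) lo<q
    split : ∀ z → Segment lo (suc len) z ⇔ (z ≡ (+ lo , 0ℤ) ⊎ Segment (suc lo) len z)
    split z = mk⇔
      (λ { (b≡0 , q , a≡q , lo≤q , q<) → case ℕP.m≤n⇒m<n∨m≡n lo≤q of λ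
             { (inj₁ lo<q) → inj₂ (b≡0 , q , a≡q , lo<q , subst (q ℕ.<_) (ℕP.+-suc lo len) q<)
             ; (inj₂ refl) → inj₁ (cong₂ _,_ a≡q b≡0) } })
      (λ { (inj₁ refl) → refl , lo , refl , ℕP.≤-refl , ℕP.m<m+n lo (s≤s z≤n)
         ; (inj₂ (b≡0 , q , a≡q , lo<q , q<)) →
             b≡0 , q , a≡q , ℕP.<⇒≤ lo<q , subst (q ℕ.<_) (sym (ℕP.+-suc lo len)) q< })

  even-or-odd : ∀ t → Σ ℕ λ s → t ≡ s ℕ.+ s ⊎ t ≡ suc (s ℕ.+ s)
  even-or-odd zero = 0 , inj₁ refl
  even-or-odd (suc t) with even-or-odd t
  ... | s , inj₁ refl = s , inj₂ refl
  ... | s , inj₂ refl = suc s , inj₁ (cong suc (sym (ℕP.+-suc s s)))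

  +-cancel-double-≤ : ∀ {m n} → m ℕ.+ m ℕ.≤ n ℕ.+ n → m ℕ.≤ n
  +-cancel-double-≤ m+m≤n+n = ℕP.≮⇒≥ λ n<m → ℕP.<⇒≱ (ℕP.+-mono-< n<m n<m) m+m≤n+n

  +-cancel-odd-double-< : ∀ {m n} → suc (m ℕ.+ m) ℕ.≤ n ℕ.+ n → m ℕ.< n
  +-cancel-odd-double-< 1+m+m≤n+n = ℕP.≰⇒> λ n≤m → ℕP.<⇒≱ (s≤s (ℕP.+-mono-≤ n≤m n≤m)) 1+m+m≤n+n

  +-cancel-double-odd-≤ : ∀ {m n} → n ℕ.+ n ℕ.≤ suc (m ℕ.+ m) → n ℕ.≤ m
  +-cancel-double-odd-≤ {m} {n} n+n≤1+m+m = ℕP.≮⇒≥ λ m<n →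
    let 2+m+m≤n+n = subst (ℕ._≤ n ℕ.+ n) (ℕP.+-suc (suc m) m) (ℕP.+-mono-≤ m<n m<n)
    in  ℕP.<⇒≱ (ℕP.<-≤-trans (ℕP.n<1+n _) 2+m+m≤n+n) n+n≤1+m+m

  lower-bound-shear : ∀ k a b → k ℤ.- b ℤ.≤ a ℤ.+ a ⇔ k ℤ.+ b ℤ.≤ (a ℤ.+ b) ℤ.+ (a ℤ.+ b)
  lower-bound-shear k a b = mk⇔
    (λ k-b≤2a → subst₂ ℤ._≤_ (solve 2 (λ k b → k :- b :+ (b :+ b) := k :+ b) refl k b)
                             (solve 2 (λ a b → a :+ a :+ (b :+ b) := a :+ b :+ (a :+ b)) refl a b)
                             (ℤP.+-monoˡ-≤ (b ℤ.+ b) k-b≤2a))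
    (λ k+b≤2[a+b] → subst₂ ℤ._≤_ (solve 2 (λ k b → k :+ b :+ (:- b :+ :- b) := k :- b) refl k b)
                                 (solve 2 (λ a b → a :+ b :+ (a :+ b) :+ (:- b :+ :- b) := a :+ a) refl a b)
                                 (ℤP.+-monoˡ-≤ (ℤ.- b ℤ.+ ℤ.- b) k+b≤2[a+b]))
    where open ℤ-Solver

  down up shear shear⁻¹ : ZPt → ZPt
  down (a , b) = (a , b ℤ.- + 1)
  up (a , b) = (a , b ℤ.+ + 1)
  shear (a , b) = (a ℤ.+ b , ℤ.- (+ 1 ℤ.+ b))
  shear⁻¹ (a , b) = (a ℤ.+ b ℤ.+ + 1 , ℤ.- (+ 1 ℤ.+ b))

  down∘up : ∀ z → down (up z) ≡ z
  down∘up (a , b) = cong (a ,_) (solve 1 (λ b → b :+ con (+ 1) :- con (+ 1) := b) refl b)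
    where open ℤ-Solver

  up∘down : ∀ z → up (down z) ≡ z
  up∘down (a , b) = cong (a ,_) (solve 1 (λ b → b :- con (+ 1) :+ con (+ 1) := b) refl b)
    where open ℤ-Solver

  shear∘shear⁻¹ : ∀ z → shear (shear⁻¹ z) ≡ z
  shear∘shear⁻¹ (a , b) = cong₂ _,_ (solve 2 (λ a b → a :+ b :+ con (+ 1) :+ :- (con (+ 1) :+ b) := a) refl a b)
                                    (solve 1 (λ b → :- (con (+ 1) :+ :- (con (+ 1) :+ b)) := b) refl b)
    where open ℤ-Solver

  shear⁻¹∘shear : ∀ z → shear⁻¹ (shear z) ≡ z
  shear⁻¹∘shear (a , b) = cong₂ _,_ (solve 2 (λ a b → a :+ b :+ :- (con (+ 1) :+ b) :+ con (+ 1) := a) refl a b)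
                                    (solve 1 (λ b → :- (con (+ 1) :+ :- (con (+ 1) :+ b)) := b) refl b)
    where open ℤ-Solver

  module Triangle (n : ℕ) where
    i m : ℕ
    i = suc n
    m = 2 ℕ.* i ℕ.+ 1

    c : ℚ
    c = + m / 2

    A B C : Pt
    A = (+ 0 / 1 , + 1 / 1)
    B = (+ 1 / 1 , -[1+ 0 ] / 1)
    C = (c , + 0 / 1)

    T : Region
    T = conv3 A B C

    c+c≡m : c + c ≡ ι (+ m)
    c+c≡m = trans (cong (λ x → x + x) (/2≡*½ (+ m)))
                  (solve 1 (λ M → M :* con ½ :+ M :* con ½ := M) refl (ι (+ m)))
      where open ℚ-Solver

    orientation-ABC : orientation A B C ≡ ι (+ (2 ℕ.* i))
    orientation-ABC = begin
      orientation A B C                ≡⟨ solve 1 (λ c →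
                                            orientationᴾ (con 0ℚ , con 1ℚ) (con 1ℚ , :- con 1ℚ) (c , con 0ℚ)
                                            := c :+ c :- con 1ℚ) refl c ⟩
      c + c - 1ℚ                       ≡⟨ cong (_- 1ℚ) (trans c+c≡m (ι-+ (+ (2 ℕ.* i)) (+ 1))) ⟩
      ι (+ (2 ℕ.* i)) + 1ℚ - 1ℚ        ≡⟨ solve 1 (λ x → x :+ con 1ℚ :- con 1ℚ := x) refl (ι (+ (2 ℕ.* i))) ⟩
      ι (+ (2 ℕ.* i))                  ∎
      where
      open ≡-Reasoning
      open ℚ-Solver

    0<orientation-ABC : 0ℚ < orientation A B C
    0<orientation-ABC = subst (0ℚ <_) (sym orientation-ABC) (ι-pos (2 ℕ.* i))

    Row : ℤ → ℤ → Set
    Row t a = t ℤ.≤ a ℤ.+ a × a ℤ.+ a ℤ.≤ + m ℤ.* t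

    LatticeTriangle : ℕ → ZPt → Set
    LatticeTriangle k (a , b) = Row (+ k ℤ.- b) a × (a ℤ.+ b) ℤ.+ (a ℤ.+ b) ℤ.≤ + m ℤ.* (+ k ℤ.+ b)

    module DilatedEdges (k : ℕ) .{{_ : ℕ.NonZero k}} (a b : ℤ) where
      open ≡-Reasoning
      open ℚ-Solver

      K x y : ℚ
      K = ι (+ k)
      x = ι a
      y = ι b

      0<½K : 0ℚ < ½ * K
      0<½K = 0<-* (ℚP.positive⁻¹ ½) (ι-pos k)

      edge-AB : 0ℚ ≤ orientation (K · A) (K · B) (x , y) ⇔ + k ℤ.- b ℤ.≤ a ℤ.+ a
      edge-AB = 0≤-scaled-difference⇔ (ι-pos k) (begin
        orientation (K · A) (K · B) (x , y)
          ≡⟨ solve 3 (λ K x y → orientationᴾ (K :* con 0ℚ , K :* con 1ℚ) (K :* con 1ℚ , K :* :- con 1ℚ) (x , y)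
                                := K :* (x :+ x :- (K :- y))) refl K x y ⟩
        K * (x + x - (K - y))
          ≡⟨ cong₂ (λ u v → K * (u - v)) (sym (ι-+ a a)) (sym (ι-minus (+ k) b)) ⟩
        K * (ι (a ℤ.+ a) - ι (+ k ℤ.- b))   ∎)

      edge-BC : 0ℚ ≤ orientation (K · B) (K · C) (x , y) ⇔ (a ℤ.+ b) ℤ.+ (a ℤ.+ b) ℤ.≤ + m ℤ.* (+ k ℤ.+ b)
      edge-BC = 0≤-scaled-difference⇔ 0<½K (begin
        orientation (K · B) (K · C) (x , y)
          ≡⟨ solve 4 (λ K c x y → orientationᴾ (K :* con 1ℚ , K :* :- con 1ℚ) (K :* c , K :* con 0ℚ) (x , y)
                                  := (con ½ :* K) :* ((c :+ c) :* (K :+ y) :- ((x :+ y) :+ (x :+ y)))) refl K c x y ⟩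
        ½ * K * ((c + c) * (K + y) - ((x + y) + (x + y)))
          ≡⟨ cong₂ (λ u v → ½ * K * (u - v)) m*[k+b] 2[a+b] ⟩
        ½ * K * (ι (+ m ℤ.* (+ k ℤ.+ b)) - ι ((a ℤ.+ b) ℤ.+ (a ℤ.+ b))) ∎)
        where
        m*[k+b] : (c + c) * (K + y) ≡ ι (+ m ℤ.* (+ k ℤ.+ b))
        m*[k+b] = trans (cong₂ _*_ c+c≡m (sym (ι-+ (+ k) b))) (sym (ι-* (+ m) (+ k ℤ.+ b)))
        2[a+b] : (x + y) + (x + y) ≡ ι ((a ℤ.+ b) ℤ.+ (a ℤ.+ b))
        2[a+b] = sym (trans (ι-+ (a ℤ.+ b) (a ℤ.+ b)) (cong₂ _+_ (ι-+ a b) (ι-+ a b)))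

      edge-CA : 0ℚ ≤ orientation (K · C) (K · A) (x , y) ⇔ a ℤ.+ a ℤ.≤ + m ℤ.* (+ k ℤ.- b)
      edge-CA = 0≤-scaled-difference⇔ 0<½K (begin
        orientation (K · C) (K · A) (x , y)
          ≡⟨ solve 4 (λ K c x y → orientationᴾ (K :* c , K :* con 0ℚ) (K :* con 0ℚ , K :* con 1ℚ) (x , y)
                                  := (con ½ :* K) :* ((c :+ c) :* (K :- y) :- (x :+ x))) refl K c x y ⟩
        ½ * K * ((c + c) * (K - y) - (x + x))
          ≡⟨ cong₂ (λ u v → ½ * K * (u - v)) m*[k-b] (sym (ι-+ a a)) ⟩
        ½ * K * (ι (+ m ℤ.* (+ k ℤ.- b)) - ι (a ℤ.+ a)) ∎)
        where
        m*[k-b] : (c + c) * (K - y) ≡ ι (+ m ℤ.* (+ k ℤ.- b))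
        m*[k-b] = trans (cong₂ _*_ c+c≡m (sym (ι-minus (+ k) b))) (sym (ι-* (+ m) (+ k ℤ.- b)))

      LeftOfEdges⇔LatticeTriangle : LeftOfEdges (K · A) (K · B) (K · C) (x , y) ⇔ LatticeTriangle k (a , b)
      LeftOfEdges⇔LatticeTriangle = mk⇔
        (λ (bc , ca , ab) → (to edge-AB ab , to edge-CA ca) , to edge-BC bc)
        (λ ((ab , ca) , bc) → from edge-BC bc , from edge-CA ca , from edge-AB ab)

    dilate⇔LatticeTriangle : ∀ k .{{_ : ℕ.NonZero k}} z → dilate k T (ιP z) ⇔ LatticeTriangle k z
    dilate⇔LatticeTriangle k (a , b) = mk⇔
      (to LeftOfEdges⇔LatticeTriangle ∘ conv3⇒LeftOfEdges {K · A} {K · B} {K · C} (ℚP.<⇒≤ 0<D) ∘ dilate-conv3⁻ k)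
      (dilate-conv3⁺ k ∘ LeftOfEdges⇒conv3 {K · A} {K · B} {K · C} 0<D ∘ from LeftOfEdges⇔LatticeTriangle)
      where
      open DilatedEdges k a b
      0<D : 0ℚ < orientation (K · A) (K · B) (K · C)
      0<D = subst (0ℚ <_) (sym (orientation-· K A B C)) (0<-* (0<-* (ι-pos k) (ι-pos k)) 0<orientation-ABC)

    ≤-m* : ∀ {u} → 0ℤ ℤ.≤ u → u ℤ.≤ + m ℤ.* u
    ≤-m* {u} 0≤u = begin
      u                          ≡⟨ sym (ℤP.+-identityʳ u) ⟩
      u ℤ.+ 0ℤ                   ≡⟨ cong (ℤ._+_ u) (sym (ℤP.*-zeroʳ (+ (2 ℕ.* i)))) ⟩
      u ℤ.+ + (2 ℕ.* i) ℤ.* 0ℤ   ≤⟨ ℤP.+-monoʳ-≤ u (ℤP.*-monoˡ-≤-nonNeg (+ (2 ℕ.* i)) 0≤u) ⟩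
      u ℤ.+ + (2 ℕ.* i) ℤ.* u    ≡⟨ solve 2 (λ u P → u :+ P :* u := (P :+ con (+ 1)) :* u) refl u (+ (2 ℕ.* i)) ⟩
      + m ℤ.* u                  ∎
      where
      open ℤP.≤-Reasoning
      open ℤ-Solver

    ≤-m*-+ : ∀ {u v d} → 0ℤ ℤ.≤ d → u ℤ.≤ + m ℤ.* v → u ℤ.+ d ℤ.≤ + m ℤ.* (v ℤ.+ d)
    ≤-m*-+ {u} {v} {d} 0≤d u≤mv = begin
      u ℤ.+ d                    ≤⟨ ℤP.+-mono-≤ u≤mv (≤-m* 0≤d) ⟩
      + m ℤ.* v ℤ.+ + m ℤ.* d    ≡⟨ sym (ℤP.*-distribˡ-+ (+ m) v d) ⟩
      + m ℤ.* (v ℤ.+ d)          ∎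
      where open ℤP.≤-Reasoning

    Row-nonNeg : ∀ {t a} → Row t a → 0ℤ ℤ.≤ t
    Row-nonNeg {t} (t≤2a , 2a≤mt) = ℤP.*-cancelˡ-≤-pos 0ℤ t (+ (2 ℕ.* i))
      (subst₂ ℤ._≤_ (sym (ℤP.*-zeroʳ (+ (2 ℕ.* i))))
                    (solve 2 (λ P t → (P :+ con (+ 1)) :* t :- t := P :* t) refl (+ (2 ℕ.* i)) t)
                    (ℤP.i≤j⇒0≤j-i (ℤP.≤-trans t≤2a 2a≤mt)))
      where open ℤ-Solver

    -- For t ≥ 0 these are the lattice points of tT on or above, resp. below, the x-axis; they are defined for
    -- every t ∈ ℤ so that the recursion on t can stop at the empty Upper (-1).
    Upper Lower : ℤ → ZPt → Set
    Upper t (a , b) = 0ℤ ℤ.≤ b × Row (t ℤ.- b) a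
    Lower t (a , b) = b ℤ.< 0ℤ × Row (t ℤ.+ b) (a ℤ.+ b)

    Line : ℤ → ZPt → Set
    Line t (a , b) = b ≡ 0ℤ × Row t a

    upper-bound-shear : ∀ k a b → 0ℤ ℤ.≤ b → a ℤ.+ a ℤ.≤ + m ℤ.* (k ℤ.- b) →
                        (a ℤ.+ b) ℤ.+ (a ℤ.+ b) ℤ.≤ + m ℤ.* (k ℤ.+ b)
    upper-bound-shear k a b 0≤b h =
      subst₂ ℤ._≤_ (solve 2 (λ a b → a :+ a :+ (b :+ b) := a :+ b :+ (a :+ b)) refl a b)
                   (cong (+ m ℤ.*_) (solve 2 (λ k b → k :- b :+ (b :+ b) := k :+ b) refl k b))
                   (≤-m*-+ (ℤP.+-mono-≤ 0≤b 0≤b) h)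
      where open ℤ-Solver

    upper-bound-shear⁻ : ∀ k a b → b ℤ.< 0ℤ → (a ℤ.+ b) ℤ.+ (a ℤ.+ b) ℤ.≤ + m ℤ.* (k ℤ.+ b) →
                         a ℤ.+ a ℤ.≤ + m ℤ.* (k ℤ.- b)
    upper-bound-shear⁻ k a b b<0 h =
      subst₂ ℤ._≤_ (solve 2 (λ a b → a :+ b :+ (a :+ b) :+ (:- b :+ :- b) := a :+ a) refl a b)
                   (cong (+ m ℤ.*_) (solve 2 (λ k b → k :+ b :+ (:- b :+ :- b) := k :- b) refl k b))
                   (≤-m*-+ (ℤP.+-mono-≤ 0≤-b 0≤-b) h)
      where
      open ℤ-Solver
      0≤-b : 0ℤ ℤ.≤ ℤ.- b
      0≤-b = ℤP.neg-mono-≤ (ℤP.<⇒≤ b<0)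

    LatticeTriangle⇔Upper⊎Lower : ∀ k z → LatticeTriangle k z ⇔ (Upper (+ k) z ⊎ Lower (+ k) z)
    LatticeTriangle⇔Upper⊎Lower k (a , b) = mk⇔
      (λ ((k-b≤2a , 2a≤m[k-b]) , 2[a+b]≤m[k+b]) → case 0ℤ ℤ.≤? b of λ
         { (yes 0≤b) → inj₁ (0≤b , k-b≤2a , 2a≤m[k-b])
         ; (no b≱0) → inj₂ (ℤP.≰⇒> b≱0 , to (lower-bound-shear (+ k) a b) k-b≤2a , 2[a+b]≤m[k+b]) })
      (λ { (inj₁ (0≤b , k-b≤2a , 2a≤m[k-b])) →
             (k-b≤2a , 2a≤m[k-b]) , upper-bound-shear (+ k) a b 0≤b 2a≤m[k-b]
         ; (inj₂ (b<0 , k+b≤2[a+b] , 2[a+b]≤m[k+b])) →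
             (from (lower-bound-shear (+ k) a b) k+b≤2[a+b] , upper-bound-shear⁻ (+ k) a b b<0 2[a+b]≤m[k+b]) ,
             2[a+b]≤m[k+b] })

    rowLength : ℕ → ℕ
    rowLength zero = 1
    rowLength (suc zero) = i
    rowLength (suc (suc t)) = 2 ℕ.* i ℕ.+ rowLength t

    rowLength-even : ∀ s → s ℕ.+ rowLength (s ℕ.+ s) ≡ suc (m ℕ.* s)
    rowLength-even zero = cong suc (sym (ℕP.*-zeroʳ m))
    rowLength-even (suc s) = begin
      suc s ℕ.+ rowLength (suc s ℕ.+ suc s)
        ≡⟨ cong (λ t → suc s ℕ.+ rowLength (suc t)) (ℕP.+-suc s s) ⟩
      suc s ℕ.+ (2 ℕ.* i ℕ.+ r)
        ≡⟨ solve 3 (λ s i r → con 1 :+ s :+ (con 2 :* i :+ r) := con 1 :+ con 2 :* i :+ (s :+ r)) refl s i r ⟩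
      suc (2 ℕ.* i ℕ.+ (s ℕ.+ r))
        ≡⟨ cong (λ r → suc (2 ℕ.* i ℕ.+ r)) (rowLength-even s) ⟩
      suc (2 ℕ.* i ℕ.+ suc (m ℕ.* s))
        ≡⟨ solve 2 (λ s i → con 1 :+ (con 2 :* i :+ (con 1 :+ (con 2 :* i :+ con 1) :* s))
                            := con 1 :+ (con 2 :* i :+ con 1) :* (con 1 :+ s)) refl s i ⟩
      suc (m ℕ.* suc s)
        ∎
      where
      open ≡-Reasoning
      open ℕ-Solver
      r : ℕ
      r = rowLength (s ℕ.+ s)

    rowLength-odd : ∀ s → suc s ℕ.+ rowLength (suc (s ℕ.+ s)) ≡ suc (m ℕ.* s ℕ.+ i)
    rowLength-odd zero = cong (λ x → suc (x ℕ.+ i)) (sym (ℕP.*-zeroʳ m))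
    rowLength-odd (suc s) = begin
      suc (suc s) ℕ.+ rowLength (suc (suc s ℕ.+ suc s))
        ≡⟨ cong (λ t → suc (suc s) ℕ.+ rowLength (suc (suc t))) (ℕP.+-suc s s) ⟩
      suc (suc s) ℕ.+ (2 ℕ.* i ℕ.+ r)
        ≡⟨ solve 3 (λ s i r → con 2 :+ s :+ (con 2 :* i :+ r) := con 1 :+ con 2 :* i :+ (con 1 :+ s :+ r)) refl s i r ⟩
      suc (2 ℕ.* i ℕ.+ (suc s ℕ.+ r))
        ≡⟨ cong (λ r → suc (2 ℕ.* i ℕ.+ r)) (rowLength-odd s) ⟩
      suc (2 ℕ.* i ℕ.+ suc (m ℕ.* s ℕ.+ i))
        ≡⟨ solve 2 (λ s i → con 1 :+ (con 2 :* i :+ (con 1 :+ ((con 2 :* i :+ con 1) :* s :+ i)))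
                            := con 1 :+ ((con 2 :* i :+ con 1) :* (con 1 :+ s) :+ i)) refl s i ⟩
      suc (m ℕ.* suc s ℕ.+ i)
        ∎
      where
      open ≡-Reasoning
      open ℕ-Solver
      r : ℕ
      r = rowLength (suc (s ℕ.+ s))

    rowLength-consecutive : ∀ t → rowLength t ℕ.+ rowLength (suc t) ≡ suc (i ℕ.* (t ℕ.+ suc t))
    rowLength-consecutive zero = cong suc (sym (ℕP.*-identityʳ i))
    rowLength-consecutive (suc t) = begin
      rowLength (suc t) ℕ.+ (2 ℕ.* i ℕ.+ rowLength t)
        ≡⟨ solve 3 (λ i r r′ → r′ :+ (con 2 :* i :+ r) := con 2 :* i :+ (r :+ r′)) refl i (rowLength t) (rowLength (suc t)) ⟩
      2 ℕ.* i ℕ.+ (rowLength t ℕ.+ rowLength (suc t))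
        ≡⟨ cong (2 ℕ.* i ℕ.+_) (rowLength-consecutive t) ⟩
      2 ℕ.* i ℕ.+ suc (i ℕ.* (t ℕ.+ suc t))
        ≡⟨ solve 2 (λ i t → con 2 :* i :+ (con 1 :+ i :* (t :+ (con 1 :+ t)))
                            := con 1 :+ i :* ((con 1 :+ t) :+ (con 2 :+ t))) refl i t ⟩
      suc (i ℕ.* (suc t ℕ.+ suc (suc t)))
        ∎
      where
      open ≡-Reasoning
      open ℕ-Solver

    rowsBelow : ℕ → ℕ
    rowsBelow zero = 0
    rowsBelow (suc t) = rowLength t ℕ.+ rowsBelow t

    rowsBelow-sum : ∀ k → rowsBelow (suc k) ℕ.+ rowsBelow k ≡ 1 ℕ.+ k ℕ.* (1 ℕ.+ k ℕ.* i)
    rowsBelow-sum zero = refl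
    rowsBelow-sum (suc k) = begin
      (rowLength (suc k) ℕ.+ rowsBelow (suc k)) ℕ.+ (rowLength k ℕ.+ rowsBelow k)
        ≡⟨ solve 4 (λ r r′ R R′ → (r′ :+ R′) :+ (r :+ R) := (r :+ r′) :+ (R′ :+ R))
                 refl (rowLength k) (rowLength (suc k)) (rowsBelow k) (rowsBelow (suc k)) ⟩
      (rowLength k ℕ.+ rowLength (suc k)) ℕ.+ (rowsBelow (suc k) ℕ.+ rowsBelow k)
        ≡⟨ cong₂ ℕ._+_ (rowLength-consecutive k) (rowsBelow-sum k) ⟩
      suc (i ℕ.* (k ℕ.+ suc k)) ℕ.+ (1 ℕ.+ k ℕ.* (1 ℕ.+ k ℕ.* i))
        ≡⟨ solve 2 (λ i k → con 1 :+ i :* (k :+ (con 1 :+ k)) :+ (con 1 :+ k :* (con 1 :+ k :* i))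
                            := con 1 :+ (con 1 :+ k) :* (con 1 :+ (con 1 :+ k) :* i)) refl i k ⟩
      1 ℕ.+ suc k ℕ.* (1 ℕ.+ suc k ℕ.* i) ∎
      where
      open ≡-Reasoning
      open ℕ-Solver

    row-even : ∀ s q → (s ℕ.+ s ℕ.≤ q ℕ.+ q × q ℕ.+ q ℕ.≤ m ℕ.* (s ℕ.+ s)) ⇔
                       (s ℕ.≤ q × q ℕ.< s ℕ.+ rowLength (s ℕ.+ s))
    row-even s q = mk⇔
      (λ (2s≤2q , 2q≤m[2s]) → +-cancel-double-≤ 2s≤2q ,
         subst (q ℕ.<_) (sym (rowLength-even s)) (s≤s (+-cancel-double-≤ (subst (q ℕ.+ q ℕ.≤_) m[2s]≡ 2q≤m[2s]))))
      (λ (s≤q , q<) → let q≤ms = ℕP.≤-pred (subst (q ℕ.<_) (rowLength-even s) q<)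
                      in  ℕP.+-mono-≤ s≤q s≤q , subst (q ℕ.+ q ℕ.≤_) (sym m[2s]≡) (ℕP.+-mono-≤ q≤ms q≤ms))
      where
      m[2s]≡ : m ℕ.* (s ℕ.+ s) ≡ m ℕ.* s ℕ.+ m ℕ.* s
      m[2s]≡ = ℕP.*-distribˡ-+ m s s

    row-odd : ∀ s q → (suc (s ℕ.+ s) ℕ.≤ q ℕ.+ q × q ℕ.+ q ℕ.≤ m ℕ.* suc (s ℕ.+ s)) ⇔
                      (suc s ℕ.≤ q × q ℕ.< suc s ℕ.+ rowLength (suc (s ℕ.+ s)))
    row-odd s q = mk⇔
      (λ (2s+1≤2q , 2q≤m[2s+1]) → +-cancel-odd-double-< 2s+1≤2q ,
         subst (q ℕ.<_) (sym (rowLength-odd s))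
               (s≤s (+-cancel-double-odd-≤ (subst (q ℕ.+ q ℕ.≤_) m[2s+1]≡ 2q≤m[2s+1]))))
      (λ (s<q , q<) → let q≤ms+i = ℕP.≤-pred (subst (q ℕ.<_) (rowLength-odd s) q<)
                      in  ℕP.≤-trans (s≤s (ℕP.+-monoʳ-≤ s (ℕP.n≤1+n s))) (ℕP.+-mono-≤ s<q s<q) ,
                          subst (q ℕ.+ q ℕ.≤_) (sym m[2s+1]≡) (ℕP.m≤n⇒m≤1+n (ℕP.+-mono-≤ q≤ms+i q≤ms+i)))
      where
      m[2s+1]≡ : m ℕ.* suc (s ℕ.+ s) ≡ suc ((m ℕ.* s ℕ.+ i) ℕ.+ (m ℕ.* s ℕ.+ i))
      m[2s+1]≡ = solve 2 (λ i s → (con 2 :* i :+ con 1) :* (con 1 :+ (s :+ s))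
                                 := con 1 :+ (((con 2 :* i :+ con 1) :* s :+ i) :+ ((con 2 :* i :+ con 1) :* s :+ i))) refl i s
        where open ℕ-Solver

    Line⇔Segment : ∀ {t lo len} →
                   (∀ q → (t ℕ.≤ q ℕ.+ q × q ℕ.+ q ℕ.≤ m ℕ.* t) ⇔ (lo ℕ.≤ q × q ℕ.< lo ℕ.+ len)) →
                   ∀ z → Line (+ t) z ⇔ Segment lo len z
    Line⇔Segment {t} row⇔ (+ q , b) = mk⇔
      (λ { (b≡0 , ℤ.+≤+ t≤2q , 2q≤mt) →
             b≡0 , q , refl , to (row⇔ q) (t≤2q , ℤP.drop‿+≤+ (subst (+ (q ℕ.+ q) ℤ.≤_) (sym (ℤP.pos-* m t)) 2q≤mt)) })
      (λ { (b≡0 , .q , refl , segment) → let t≤2q , 2q≤mt = from (row⇔ q) segment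
                                         in  b≡0 , ℤ.+≤+ t≤2q , subst (+ (q ℕ.+ q) ℤ.≤_) (ℤP.pos-* m t) (ℤ.+≤+ 2q≤mt) })
    Line⇔Segment row⇔ (-[1+ q ] , b) = mk⇔ (λ { (_ , () , _) }) (λ { (_ , _ , () , _) })

    HasCard-Line : ∀ t → HasCard (Line (+ t)) (rowLength t)
    HasCard-Line t with even-or-odd t
    ... | s , inj₁ refl = HasCard-cong (Line⇔Segment (row-even s)) (HasCard-Segment s (rowLength (s ℕ.+ s)))
    ... | s , inj₂ refl = HasCard-cong (Line⇔Segment (row-odd s)) (HasCard-Segment (suc s) (rowLength (suc (s ℕ.+ s))))

    Upper-below-zero : ∀ z → ¬ Upper (+ 0 ℤ.- + 1) z
    Upper-below-zero (a , b) (0≤b , row) with ℤP.≤-trans 0≤b (ℤP.0≤i-j⇒j≤i {i = -[1+ 0 ]} (Row-nonNeg {a = a} row))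
    ... | ()

    Upper-step : ∀ t z → Upper t z ⇔ (Line t z ⊎ Upper (t ℤ.- + 1) (down z))
    Upper-step t (a , b) = mk⇔
      (λ (0≤b , row) → case b ℤ.≟ 0ℤ of λ
         { (yes refl) → inj₁ (refl , subst (λ s → Row s a) (ℤP.+-identityʳ t) row)
         ; (no b≢0) → inj₂ (ℤP.i≤j⇒0≤j-i (ℤP.i<j⇒suc[i]≤j (ℤP.≤∧≢⇒< 0≤b (b≢0 ∘ sym))) ,
                            subst (λ s → Row s a) (solve 2 (λ t b → t :- b := t :- con (+ 1) :- (b :- con (+ 1))) refl t b)
                                  row) })
      (λ { (inj₁ (refl , row)) → ℤP.≤-refl , subst (λ s → Row s a) (sym (ℤP.+-identityʳ t)) row
         ; (inj₂ (0≤b-1 , row)) →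
             ℤP.≤-trans (ℤ.+≤+ z≤n) (ℤP.0≤i-j⇒j≤i 0≤b-1) ,
             subst (λ s → Row s a) (solve 2 (λ t b → t :- con (+ 1) :- (b :- con (+ 1)) := t :- b) refl t b) row })
      where open ℤ-Solver

    Lower⇔Upper∘shear : ∀ t z → Lower t z ⇔ Upper (t ℤ.- + 1) (shear z)
    Lower⇔Upper∘shear t (a , b) = mk⇔
      (λ (b<0 , row) → ℤP.neg-mono-≤ (ℤP.i<j⇒suc[i]≤j b<0) , subst (λ s → Row s (a ℤ.+ b)) t+b≡ row)
      (λ (0≤-[1+b] , row) → ℤP.suc[i]≤j⇒i<j (ℤP.neg-cancel-≤ 0≤-[1+b]) , subst (λ s → Row s (a ℤ.+ b)) (sym t+b≡) row)
      where
      open ℤ-Solver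
      t+b≡ : t ℤ.+ b ≡ t ℤ.- + 1 ℤ.- ℤ.- (+ 1 ℤ.+ b)
      t+b≡ = solve 2 (λ t b → t :+ b := t :- con (+ 1) :- (:- (con (+ 1) :+ b))) refl t b

    HasCard-Upper : ∀ k → HasCard (Upper (+ k ℤ.- + 1)) (rowsBelow k)
    HasCard-Upper zero = HasCard-∅ Upper-below-zero
    HasCard-Upper (suc k) =
      HasCard-cong (Upper-step (+ k))
        (HasCard-⊎ (HasCard-Line k) (HasCard-∘ down up down∘up up∘down (HasCard-Upper k)) line∉shifted)
      where
      line∉shifted : ∀ z → Line (+ k) z → ¬ Upper (+ k ℤ.- + 1) (down z)
      line∉shifted (a , .0ℤ) (refl , _) (() , _)

    HasCard-Lower : ∀ k → HasCard (Lower (+ k)) (rowsBelow k)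
    HasCard-Lower k =
      HasCard-cong (Lower⇔Upper∘shear (+ k)) (HasCard-∘ shear shear⁻¹ shear∘shear⁻¹ shear⁻¹∘shear (HasCard-Upper k))

    HasCard-LatticeTriangle : ∀ k → HasCard (LatticeTriangle k) (rowsBelow (suc k) ℕ.+ rowsBelow k)
    HasCard-LatticeTriangle k =
      HasCard-cong (LatticeTriangle⇔Upper⊎Lower k)
        (HasCard-⊎ (HasCard-Upper (suc k)) (HasCard-Lower k) λ { _ (0≤b , _) (b<0 , _) → ℤP.<⇒≱ b<0 0≤b })

    latticeCount-polynomial : ∀ k →
      ι (+ (1 ℕ.+ k ℕ.* (1 ℕ.+ k ℕ.* i))) ≡ evalPoly (1ℚ ∷ 1ℚ ∷ ι (+ i) ∷ []) (ι (+ k))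
    latticeCount-polynomial k = begin
      ι (+ (1 ℕ.+ k ℕ.* (1 ℕ.+ k ℕ.* i)))  ≡⟨ ι-+ (+ 1) (+ (k ℕ.* (1 ℕ.+ k ℕ.* i))) ⟩
      1ℚ + ι (+ (k ℕ.* (1 ℕ.+ k ℕ.* i)))   ≡⟨ cong (_+_ 1ℚ) (ι-ℕ-* k (1 ℕ.+ k ℕ.* i)) ⟩
      1ℚ + K * ι (+ (1 ℕ.+ k ℕ.* i))       ≡⟨ cong (λ r → 1ℚ + K * r) (ι-+ (+ 1) (+ (k ℕ.* i))) ⟩
      1ℚ + K * (1ℚ + ι (+ (k ℕ.* i)))      ≡⟨ cong (λ r → 1ℚ + K * (1ℚ + r)) (ι-ℕ-* k i) ⟩
      1ℚ + K * (1ℚ + K * ι (+ i))          ≡⟨ solve 2 (λ K I → con 1ℚ :+ K :* (con 1ℚ :+ K :* I)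
                                                    := con 1ℚ :+ K :* (con 1ℚ :+ K :* (I :+ K :* con 0ℚ))) refl K (ι (+ i)) ⟩
      1ℚ + K * (1ℚ + K * (ι (+ i) + K * 0ℚ)) ∎
      where
      open ≡-Reasoning
      open ℚ-Solver
      K : ℚ
      K = ι (+ k)

    T-pseudoIntegral : PseudoIntegral T
    T-pseudoIntegral = 1ℚ ∷ 1ℚ ∷ ι (+ i) ∷ [] , λ
      { zero () ; (suc k) _ →
        rowsBelow (suc (suc k)) ℕ.+ rowsBelow (suc k) ,
        HasCard-cong (dilate⇔LatticeTriangle (suc k)) (HasCard-LatticeTriangle (suc k)) ,
        trans (cong (λ n → ι (+ n)) (rowsBelow-sum (suc k))) (latticeCount-polynomial (suc k)) }

    T-nonDegenerate : NonDegenerate A B C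
    T-nonDegenerate D≡0 = ℚP.<⇒≢ 0<orientation-ABC (sym D≡0)

    m≢a+a : ∀ a → + m ≢ a ℤ.+ a
    m≢a+a (+ q) m≡q+q = ℕP.even≢odd q i (begin
      2 ℕ.* q          ≡⟨ cong (q ℕ.+_) (ℕP.+-identityʳ q) ⟩
      q ℕ.+ q          ≡⟨ sym (ℤP.+-injective m≡q+q) ⟩
      2 ℕ.* i ℕ.+ 1    ≡⟨ ℕP.+-comm (2 ℕ.* i) 1 ⟩
      suc (2 ℕ.* i)    ∎)
      where open ≡-Reasoning
    m≢a+a -[1+ q ] ()

    c-not-integral : ∀ a → c ≢ ι a
    c-not-integral a c≡a = m≢a+a a (ι-injective (begin
      ι (+ m)          ≡⟨ sym c+c≡m ⟩
      c + c            ≡⟨ cong₂ _+_ c≡a c≡a ⟩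
      ι a + ι a        ≡⟨ sym (ι-+ a a) ⟩
      ι (a ℤ.+ a)      ∎))
      where open ≡-Reasoning

    T-halfIntegral : HalfIntegral A B C
    T-halfIntegral =
      ((+ 0 , + 2 , refl , refl) , (+ 2 , -[1+ 1 ] , refl , refl) , (+ m , + 0 , 2c≡m , refl)) ,
      λ { (suc zero) _ _ (_ , _ , a , _ , 1*c≡a , _) → c-not-integral a (trans (sym (ℚP.*-identityˡ c)) 1*c≡a)
        ; (suc (suc _)) _ (s≤s (s≤s ())) }
      where
      2c≡m : (+ 2 / 1) * c ≡ ι (+ m)
      2c≡m = trans (solve 1 (λ c → con (+ 2 / 1) :* c := c :+ c) refl c) c+c≡m
        where open ℚ-Solver

    1≤c : 1ℚ ≤ c
    1≤c = begin
      1ℚ                ≡⟨⟩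
      ι (+ 2) * ½       ≤⟨ ℚP.*-monoʳ-≤-nonNeg ½ (ι-mono-≤ {+ 2} {+ m} (ℤ.+≤+ 2≤m)) ⟩
      ι (+ m) * ½       ≡⟨ sym (/2≡*½ (+ m)) ⟩
      c                 ∎
      where
      open ℚP.≤-Reasoning
      2≤m : 2 ℕ.≤ m
      2≤m = ℕP.≤-trans (ℕP.*-monoʳ-≤ 2 (s≤s z≤n)) (ℕP.m≤m+n (2 ℕ.* i) 1)

    0≤c : 0ℚ ≤ c
    0≤c = ℚP.≤-trans (ℚP.nonNegative⁻¹ 1ℚ) 1≤c

    -- L = c + 2 bounds the ℓ¹-length of every edge, and at (q, 0) with 1 ≤ q ≤ i every orientation is at least ½,
    -- so the box of radius ε = ½ / L around (q, 0) stays inside T.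
    module InteriorMargins where
      L ε : ℚ
      L = c + ι (+ 2)
      instance
        L-positive : ℚ.Positive L
        L-positive = ℚP.pos+pos⇒pos c {{ℚP.normalize-pos m 2}} (ι (+ 2))
        L-nonZero : ℚ.NonZero L
        L-nonZero = ℚP.pos⇒nonZero L
      ε = ½ * ℚ.1/ L

      0<ε : 0ℚ < ε
      0<ε = 0<-* (ℚP.positive⁻¹ ½) (ℚP.positive⁻¹ (ℚ.1/ L) {{ℚP.1/pos⇒pos L}})

      margin : ∀ {ℓ o} → ℓ ≤ L → ½ ≤ o → ℓ * ε ≤ o
      margin {ℓ} {o} ℓ≤L ½≤o = begin
        ℓ * ε        ≤⟨ ℚP.*-monoʳ-≤-nonNeg ε {{ℚ.nonNegative (ℚP.<⇒≤ 0<ε)}} ℓ≤L ⟩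
        L * ε        ≡⟨ solve 2 (λ L r → L :* (con ½ :* r) := con ½ :* (L :* r)) refl L (ℚ.1/ L) ⟩
        ½ * (L * ℚ.1/ L) ≡⟨ cong (½ *_) (ℚP.*-inverseʳ L) ⟩
        ½ * 1ℚ       ≡⟨⟩
        ½            ≤⟨ ½≤o ⟩
        o            ∎
        where
        open ℚP.≤-Reasoning
        open ℚ-Solver

      ℓ¹-AB : ℓ¹ A B ≤ L
      ℓ¹-AB = ℚP.+-monoˡ-≤ (ι (+ 2)) 1≤c

      ℓ¹-BC : ℓ¹ B C ≤ L
      ℓ¹-BC = begin
        ℚ.∣ c - 1ℚ ∣ + 1ℚ          ≤⟨ ℚP.+-monoˡ-≤ 1ℚ (ℚP.∣p-q∣≤∣p∣+∣q∣ c 1ℚ) ⟩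
        ℚ.∣ c ∣ + 1ℚ + 1ℚ          ≡⟨ cong (λ r → r + 1ℚ + 1ℚ) (ℚP.0≤p⇒∣p∣≡p 0≤c) ⟩
        c + 1ℚ + 1ℚ                ≡⟨ ℚP.+-assoc c 1ℚ 1ℚ ⟩
        L                          ∎
        where open ℚP.≤-Reasoning

      ℓ¹-CA : ℓ¹ C A ≤ L
      ℓ¹-CA = begin
        ℚ.∣ 0ℚ - c ∣ + 1ℚ          ≤⟨ ℚP.+-monoˡ-≤ 1ℚ (ℚP.∣p-q∣≤∣p∣+∣q∣ 0ℚ c) ⟩
        0ℚ + ℚ.∣ c ∣ + 1ℚ          ≡⟨ cong (λ r → r + 1ℚ) (trans (ℚP.+-identityˡ ℚ.∣ c ∣) (ℚP.0≤p⇒∣p∣≡p 0≤c)) ⟩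
        c + 1ℚ                     ≤⟨ ℚP.+-monoʳ-≤ c (ι-mono-≤ {+ 1} {+ 2} (ℤ.+≤+ (s≤s z≤n))) ⟩
        L                          ∎
        where open ℚP.≤-Reasoning

      module _ (q : ℕ) (1≤q : 1 ℕ.≤ q) (q≤i : q ℕ.≤ i) where
        x : ℚ
        x = ι (+ q)

        2q+1≤m : suc (q ℕ.+ q) ℕ.≤ m
        2q+1≤m = subst (suc (q ℕ.+ q) ℕ.≤_) (solve 1 (λ i → con 1 :+ (i :+ i) := con 2 :* i :+ con 1) refl i)
                       (s≤s (ℕP.+-mono-≤ q≤i q≤i))
          where open ℕ-Solver

        ½≤c-x : ½ ≤ c - x
        ½≤c-x = begin
          ½                         ≡⟨ solve 2 (λ x h → h := x :+ h :- x) refl x ½ ⟩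
          x + ½ - x                 ≤⟨ ℚP.+-monoˡ-≤ (- x) x+½≤c ⟩
          c - x                     ∎
          where
          open ℚP.≤-Reasoning
          open ℚ-Solver
          x+½≤c : x + ½ ≤ c
          x+½≤c = begin
            x + ½                       ≡⟨ solve 1 (λ x → x :+ con ½ := (con 1ℚ :+ (x :+ x)) :* con ½) refl x ⟩
            (1ℚ + (x + x)) * ½          ≡⟨ cong (λ r → (1ℚ + r) * ½) (sym (ι-+ (+ q) (+ q))) ⟩
            (1ℚ + ι (+ (q ℕ.+ q))) * ½  ≡⟨ cong (_* ½) (sym (ι-+ (+ 1) (+ (q ℕ.+ q)))) ⟩
            ι (+ suc (q ℕ.+ q)) * ½     ≤⟨ ℚP.*-monoʳ-≤-nonNeg ½ (ι-mono-≤ (ℤ.+≤+ 2q+1≤m)) ⟩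
            ι (+ m) * ½                 ≡⟨ sym (/2≡*½ (+ m)) ⟩
            c                           ∎

        ½≤2x-1 : ½ ≤ x + x - 1ℚ
        ½≤2x-1 = begin
          ½                 ≤⟨ ℚ.*≤* (ℤ.+≤+ (s≤s z≤n)) ⟩
          1ℚ + 1ℚ - 1ℚ      ≤⟨ ℚP.+-monoˡ-≤ (- 1ℚ) (ℚP.+-mono-≤ 1≤x 1≤x) ⟩
          x + x - 1ℚ        ∎
          where
          open ℚP.≤-Reasoning
          1≤x : 1ℚ ≤ x
          1≤x = ι-mono-≤ (ℤ.+≤+ 1≤q)

        segment-interior : Interior T (x , 0ℚ)
        segment-interior = conv3-interior {A} {B} {C} {x} {0ℚ} {ε} 0<orientation-ABC 0<ε
          (margin ℓ¹-BC (subst (½ ≤_) (sym BC≡) ½≤c-x))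
          (margin ℓ¹-CA (subst (½ ≤_) (sym CA≡) ½≤c-x))
          (margin ℓ¹-AB (subst (½ ≤_) (sym AB≡) ½≤2x-1))
          where
          open ℚ-Solver
          BC≡ : orientation B C (x , 0ℚ) ≡ c - x
          BC≡ = solve 2 (λ c x → orientationᴾ (con 1ℚ , :- con 1ℚ) (c , con 0ℚ) (x , con 0ℚ) := c :- x) refl c x
          CA≡ : orientation C A (x , 0ℚ) ≡ c - x
          CA≡ = solve 2 (λ c x → orientationᴾ (c , con 0ℚ) (con 0ℚ , con 1ℚ) (x , con 0ℚ) := c :- x) refl c x
          AB≡ : orientation A B (x , 0ℚ) ≡ x + x - 1ℚ
          AB≡ = solve 1 (λ x → orientationᴾ (con 0ℚ , con 1ℚ) (con 1ℚ , :- con 1ℚ) (x , con 0ℚ)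
                               := x :+ x :- con 1ℚ) refl x

    open InteriorMargins using (segment-interior)

    A′ B′ : ZPt
    A′ = (+ 0 , + 1)
    B′ = (+ 1 , -[1+ 0 ])

    T⇔LatticeTriangle-1 : ∀ z → T (ιP z) ⇔ LatticeTriangle 1 z
    T⇔LatticeTriangle-1 z =
      mk⇔ (to (dilate⇔LatticeTriangle 1 z) ∘ dilate-1⁺) (dilate-1⁻ ∘ from (dilate⇔LatticeTriangle 1 z))

    Line-0⇒origin : ∀ z → Line (+ 0) z → z ≡ (0ℤ , 0ℤ)
    Line-0⇒origin z line with to (Line⇔Segment (row-even 0) z) line
    ... | refl , zero , refl , _ = refl
    ... | _ , suc _ , _ , _ , s≤s ()

    origin∈Line-0 : Line (+ 0) (0ℤ , 0ℤ)
    origin∈Line-0 = from (Line⇔Segment (row-even 0) _) (refl , 0 , refl , z≤n , s≤s z≤n)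

    LatticeTriangle-1⇒ : ∀ z → LatticeTriangle 1 z → z ≡ A′ ⊎ z ≡ B′ ⊎ Line (+ 1) z
    LatticeTriangle-1⇒ z z∈ with to (LatticeTriangle⇔Upper⊎Lower 1 z) z∈
    ... | inj₂ lower = inj₂ (inj₁ (case to (Upper-step (+ 0) (shear z)) (to (Lower⇔Upper∘shear (+ 1) z) lower) of λ
            { (inj₁ line) → trans (sym (shear⁻¹∘shear z)) (cong shear⁻¹ (Line-0⇒origin (shear z) line))
            ; (inj₂ upper) → ⊥-elim (Upper-below-zero (down (shear z)) upper) }))
    ... | inj₁ upper with to (Upper-step (+ 1) z) upper
    ...   | inj₁ line = inj₂ (inj₂ line)
    ...   | inj₂ upper₀ = inj₁ (case to (Upper-step (+ 0) (down z)) upper₀ of λ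
            { (inj₁ line) → trans (sym (up∘down z)) (cong up (Line-0⇒origin (down z) line))
            ; (inj₂ upper) → ⊥-elim (Upper-below-zero (down (down z)) upper) })

    A′∈ : LatticeTriangle 1 A′
    A′∈ = from (LatticeTriangle⇔Upper⊎Lower 1 A′)
            (inj₁ (from (Upper-step (+ 1) A′) (inj₂ (from (Upper-step (+ 0) (down A′)) (inj₁ origin∈Line-0)))))

    B′∈ : LatticeTriangle 1 B′
    B′∈ = from (LatticeTriangle⇔Upper⊎Lower 1 B′)
            (inj₂ (from (Lower⇔Upper∘shear (+ 1) B′) (from (Upper-step (+ 0) (shear B′)) (inj₁ origin∈Line-0))))

    AB-not-interior : ∀ x y → orientation A B (x , y) ≡ 0ℚ → ¬ Interior T (x , y)
    AB-not-interior x y o≡0 x,y-interior =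
      let δ , 0<δ , shifted∈T = Interior-shiftˡ x,y-interior
          _ , _ , 0≤o = conv3⇒LeftOfEdges {A} {B} {C} (ℚP.<⇒≤ 0<orientation-ABC) shifted∈T
          0≤-2δ : 0ℚ ≤ 0ℚ - (δ + δ)
          0≤-2δ = subst (0ℚ ≤_) (trans (solve 3 (λ x y δ →
                      orientationᴾ (con 0ℚ , con 1ℚ) (con 1ℚ , :- con 1ℚ) (x :- δ , y)
                      := orientationᴾ (con 0ℚ , con 1ℚ) (con 1ℚ , :- con 1ℚ) (x , y) :- (δ :+ δ)) refl x y δ)
                    (cong (_- (δ + δ)) o≡0)) 0≤o
      in  ℚP.<-irrefl refl (ℚP.<-≤-trans (ℚP.+-mono-< 0<δ 0<δ) (0≤-⇒≤ 0≤-2δ))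
      where open ℚ-Solver

    A′-not-interior : ¬ Interior T (ιP A′)
    A′-not-interior = AB-not-interior (ι (+ 0)) (ι (+ 1)) refl

    B′-not-interior : ¬ Interior T (ιP B′)
    B′-not-interior = AB-not-interior (ι (+ 1)) (ι -[1+ 0 ]) refl

    Interior⇔Segment : ∀ z → Interior T (ιP z) ⇔ Segment 1 i z
    Interior⇔Segment z = mk⇔
      (λ z-interior → case LatticeTriangle-1⇒ z (to (T⇔LatticeTriangle-1 z) (Interior⇒∈ z-interior)) of λ
        { (inj₁ refl) → ⊥-elim (A′-not-interior z-interior)
        ; (inj₂ (inj₁ refl)) → ⊥-elim (B′-not-interior z-interior)
        ; (inj₂ (inj₂ line)) → to (Line⇔Segment (row-odd 0) z) line })
      (λ { (refl , q , refl , 1≤q , q<1+i) → segment-interior q 1≤q (ℕP.≤-pred q<1+i) })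

    T-interior : HasCard (LatticePts (Interior T)) i
    T-interior = HasCard-cong Interior⇔Segment (HasCard-Segment 1 i)

    Boundary⇔A′⊎B′ : ∀ z → Boundary T (ιP z) ⇔ (z ≡ A′ ⊎ z ≡ B′)
    Boundary⇔A′⊎B′ z = mk⇔
      (λ (z∈T , z-not-interior) → case LatticeTriangle-1⇒ z (to (T⇔LatticeTriangle-1 z) z∈T) of λ
         { (inj₁ z≡A′) → inj₁ z≡A′
         ; (inj₂ (inj₁ z≡B′)) → inj₂ z≡B′
         ; (inj₂ (inj₂ line)) →
             ⊥-elim (z-not-interior (from (Interior⇔Segment z) (to (Line⇔Segment (row-odd 0) z) line))) })
      (λ { (inj₁ refl) → from (T⇔LatticeTriangle-1 A′) A′∈ , A′-not-interior
         ; (inj₂ refl) → from (T⇔LatticeTriangle-1 B′) B′∈ , B′-not-interior })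

    T-boundary : HasCard (LatticePts (Boundary T)) 2
    T-boundary = HasCard-cong Boundary⇔A′⊎B′ (HasCard-⊎ (HasCard-≡ A′) (HasCard-≡ B′) λ { _ refl () })

open import Data.Nat using (_≤_; _*_; _+_)

proposition3p1 : (i : ℕ) → 1 ≤ i →
    let a = (+ 0 / 1 , + 1 / 1)
        b = (+ 1 / 1 , -[1+ 0 ] / 1)
        c = (+ (2 * i + 1) / 2 , + 0 / 1)
        T = conv3 a b c
    in NonDegenerate a b c × HalfIntegral a b c × PseudoIntegral T ×
       HasCard (LatticePts (Interior T)) i × HasCard (LatticePts (Boundary T)) 2
proposition3p1 (suc n) (s≤s z≤n) = T-nonDegenerate , T-halfIntegral , T-pseudoIntegral , T-interior , T-boundary
  where open Triangle n
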